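{- Let $c\ge2$ and $1\le s\le c-1$ be integers, and let $\mathcal{C}\subseteq[q]^n$ be a code with minimum distance $d(\mathcal{C})>\lfloor\frac{c-s}{c}n\rfloor$. Then $\mathcal{C}$ is $(c,s)$-frameproof.
   Context: $[m]=\{1,\dots,m\}$. The Hamming distance of $\bm x,\bm y\in[q]^n$ is $d(\bm x,\bm y)=|\{i\in[n]:x_i\neq y_i\}|$, and $d(\mathcal{C})=\min\{d(\bm x,\bm y):\bm x,\bm y\in\mathcal{C}\text{ distinct}\}$. A code $\mathcal{C}\subseteq[q]^n$ is $(c,s)$-frameproof if for every $c+1$ codewords $\bm x^0,\dots,\bm x^c\in\mathcal{C}$ with $\bm x^0\neq\bm x^j$ for each $j\in[c]$ ($\bm x^1,\dots,\bm x^c$ not necessarily distinct), there is a coordinate $i\in[n]$ with $|\{j\in[c]:x^j_i=x^0_i\}|<s$. -}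

module Defs where

open import Data.Nat using (ℕ; _<_; _*_; _∸_; _/_; NonZero)
open import Data.Fin using (Fin)
open import Data.Fin.Properties using (_≟_)
open import Data.List using (List; length; filter)
open import Data.List.Base using (allFin)
open import Data.Product using (∃; _×_)
open import Relation.Binary.PropositionalEquality using (_≡_)
open import Relation.Nullary using (¬_; ¬?)

Word : ℕ → ℕ → Set
Word q n = Fin n → Fin q

Code : ℕ → ℕ → Set₁
Code q n = Word q n → Set

hamming : ∀ {q n} → Word q n → Word q n → ℕ
hamming {n = n} x y = length (filter (λ i → ¬? (x i ≟ y i)) (allFin n))

agreeCount : ∀ {q n c} → (Fin c → Word q n) → Word q n → Fin n → ℕ
agreeCount {c = c} xs x0 i = length (filter (λ j → xs j i ≟ x0 i) (allFin c))

Frameproof : ∀ {q n} → (c s : ℕ) → Code q n → Set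
Frameproof {q} {n} c s C =
  (x0 : Word q n) (xs : Fin c → Word q n) →
  C x0 → (∀ j → C (xs j)) → (∀ j → ¬ (x0 ≡ xs j)) →
  ∃ λ (i : Fin n) → agreeCount xs x0 i < s

MinDistGreater : ∀ {q n} → Code q n → ℕ → Set
MinDistGreater {q} {n} C m =
  ∀ (x y : Word q n) → C x → C y → ¬ (x ≡ y) → m < hamming x y

-- Double count the agreements of x⁰ with x¹, …, xᶜ. If every coordinate had
-- at least s of them, the total would be at least n s; but each xʲ agrees with
-- x⁰ in at most n − (m + 1) coordinates, where m = ⌊(c − s) n / c⌋, so the
-- total is at most c (n − m − 1). Hence c (m + 1) ≤ (c − s) n, i.e. m + 1 ≤ m.
module Submission where

open import Defs
open import Data.Nat using (ℕ; zero; suc; _+_; _≤_; _<_; _*_; _∸_; _/_; NonZero; z≤n; _≤?_)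
open import Data.Nat.Properties hiding (_≟_)
open import Data.Nat.DivMod using (m*n/n≡m; /-monoˡ-≤)
open import Data.Fin using (Fin; zero; suc)
open import Data.Fin.Properties using (_≟_; ¬∀⟶∃¬)
open import Data.List using (length; filter; tabulate)
open import Data.Product using (map₂)
open import Function using (_∘_)
open import Relation.Binary.PropositionalEquality
open import Relation.Nullary using (Dec; yes; no; ¬?; contradiction)
open import Relation.Unary using (Pred; Decidable)
open import Algebra.Properties.CommutativeMonoid.Sum +-0-commutativeMonoid
  using (sum-syntax; sum-cong-≗; ∑-distrib-+; ∑-comm)

𝟙 : ∀ {p} {P : Set p} → Dec P → ℕ
𝟙 (yes _) = 1
𝟙 (no _)  = 0

length-filter-tabulate : ∀ {a p} {A : Set a} {P : Pred A p} (P? : Decidable P) {k} (f : Fin k → A) →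
  length (filter P? (tabulate f)) ≡ ∑[ i < k ] 𝟙 (P? (f i))
length-filter-tabulate P? {zero}  f = refl
length-filter-tabulate P? {suc k} f with P? (f zero)
... | yes _ = cong suc (length-filter-tabulate P? (f ∘ suc))
... | no _  = length-filter-tabulate P? (f ∘ suc)

∑-const : ∀ k a → ∑[ i < k ] a ≡ k * a
∑-const zero    a = refl
∑-const (suc k) a = cong (a +_) (∑-const k a)

∑-mono-≤ : ∀ {k} {f g : Fin k → ℕ} → (∀ i → f i ≤ g i) → ∑[ i < k ] f i ≤ ∑[ i < k ] g i
∑-mono-≤ {zero}  f≤g = z≤n
∑-mono-≤ {suc k} f≤g = +-mono-≤ (f≤g zero) (∑-mono-≤ (f≤g ∘ suc))

agreements : ∀ {q n} → Word q n → Word q n → ℕ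
agreements {n = n} x y = ∑[ i < n ] 𝟙 (x i ≟ y i)

hamming+agreements : ∀ {q n} (x y : Word q n) → hamming x y + agreements y x ≡ n
hamming+agreements {n = n} x y = begin
  hamming x y + agreements y x
    ≡⟨ cong (_+ agreements y x) (length-filter-tabulate (λ i → ¬? (x i ≟ y i)) (λ i → i)) ⟩
  ∑[ i < n ] 𝟙 (¬? (x i ≟ y i)) + ∑[ i < n ] 𝟙 (y i ≟ x i)
    ≡⟨ ∑-distrib-+ (λ i → 𝟙 (¬? (x i ≟ y i))) (λ i → 𝟙 (y i ≟ x i)) ⟨
  ∑[ i < n ] (𝟙 (¬? (x i ≟ y i)) + 𝟙 (y i ≟ x i))
    ≡⟨ sum-cong-≗ (λ i → partition-of-unity (x i) (y i)) ⟩
  ∑[ i < n ] 1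
    ≡⟨ ∑-const n 1 ⟩
  n * 1
    ≡⟨ *-identityʳ n ⟩
  n ∎
  where
  open ≡-Reasoning
  partition-of-unity : ∀ {q} (a b : Fin q) → 𝟙 (¬? (a ≟ b)) + 𝟙 (b ≟ a) ≡ 1
  partition-of-unity a b with a ≟ b | b ≟ a
  ... | yes _   | yes _   = refl
  ... | no _    | no _    = refl
  ... | yes a≡b | no b≢a  = contradiction (sym a≡b) b≢a
  ... | no a≢b  | yes b≡a = contradiction (sym b≡a) a≢b

∑-agreeCount+∑-hamming : ∀ {q n c} (x0 : Word q n) (xs : Fin c → Word q n) →
  ∑[ i < n ] agreeCount xs x0 i + ∑[ j < c ] hamming x0 (xs j) ≡ c * n
∑-agreeCount+∑-hamming {n = n} {c} x0 xs = begin
  ∑[ i < n ] agreeCount xs x0 i + ∑[ j < c ] hamming x0 (xs j)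
    ≡⟨ cong (_+ ∑[ j < c ] hamming x0 (xs j)) ∑-agreeCount ⟩
  ∑[ j < c ] agreements (xs j) x0 + ∑[ j < c ] hamming x0 (xs j)
    ≡⟨ +-comm (∑[ j < c ] agreements (xs j) x0) (∑[ j < c ] hamming x0 (xs j)) ⟩
  ∑[ j < c ] hamming x0 (xs j) + ∑[ j < c ] agreements (xs j) x0
    ≡⟨ ∑-distrib-+ (λ j → hamming x0 (xs j)) (λ j → agreements (xs j) x0) ⟨
  ∑[ j < c ] (hamming x0 (xs j) + agreements (xs j) x0)
    ≡⟨ sum-cong-≗ (λ j → hamming+agreements x0 (xs j)) ⟩
  ∑[ j < c ] n
    ≡⟨ ∑-const c n ⟩
  c * n ∎
  where
  open ≡-Reasoning
  ∑-agreeCount : ∑[ i < n ] agreeCount xs x0 i ≡ ∑[ j < c ] agreements (xs j) x0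
  ∑-agreeCount = trans
    (sum-cong-≗ (λ i → length-filter-tabulate (λ j → xs j i ≟ x0 i) (λ j → j)))
    (∑-comm (λ i j → 𝟙 (xs j i ≟ x0 i)))

double-count-≤ : ∀ {q n c s d} (x0 : Word q n) (xs : Fin c → Word q n) →
  (∀ i → s ≤ agreeCount xs x0 i) → (∀ j → d ≤ hamming x0 (xs j)) → c * d + n * s ≤ c * n
double-count-≤ {n = n} {c} {s} {d} x0 xs s≤agree d≤dist = begin
  c * d + n * s
    ≡⟨ +-comm (c * d) (n * s) ⟩
  n * s + c * d
    ≡⟨ cong₂ _+_ (∑-const n s) (∑-const c d) ⟨
  ∑[ i < n ] s + ∑[ j < c ] d
    ≤⟨ +-mono-≤ (∑-mono-≤ s≤agree) (∑-mono-≤ d≤dist) ⟩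
  ∑[ i < n ] agreeCount xs x0 i + ∑[ j < c ] hamming x0 (xs j)
    ≡⟨ ∑-agreeCount+∑-hamming x0 xs ⟩
  c * n ∎
  where open ≤-Reasoning

*≤⇒≤/ : ∀ {k m} c .{{_ : NonZero c}} → k * c ≤ m → k ≤ m / c
*≤⇒≤/ {k} c k*c≤m = subst (_≤ _) (m*n/n≡m k c) (/-monoˡ-≤ c k*c≤m)

c*d+n*s≤c*n⇒d≤[c∸s]*n/c : ∀ {n c s d} .{{_ : NonZero c}} → c * d + n * s ≤ c * n → d ≤ (c ∸ s) * n / c
c*d+n*s≤c*n⇒d≤[c∸s]*n/c {n} {c} {s} {d} ineq = *≤⇒≤/ c (begin
  d * c           ≡⟨ *-comm d c ⟩
  c * d           ≤⟨ m+n≤o⇒m≤o∸n (c * d) ineq ⟩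
  c * n ∸ n * s   ≡⟨ cong (_∸ n * s) (*-comm c n) ⟩
  n * c ∸ n * s   ≡⟨ *-distribˡ-∸ n c s ⟨
  n * (c ∸ s)     ≡⟨ *-comm n (c ∸ s) ⟩
  (c ∸ s) * n     ∎)
  where open ≤-Reasoning

-- The counting argument needs none of the hypotheses on c and s.
lemma3p4 : (q n c s : ℕ) → .{{_ : NonZero c}} → 2 ≤ c → 1 ≤ s → s ≤ c ∸ 1 →
    (C : Code q n) → MinDistGreater C (((c ∸ s) * n) / c) → Frameproof c s C
lemma3p4 q n c s _ _ _ C d>m x0 xs x0∈C xs∈C x0≢xs =
  map₂ ≰⇒> (¬∀⟶∃¬ n _ (λ i → s ≤? agreeCount xs x0 i) (n≮n m ∘ m<m))
  where
  m = ((c ∸ s) * n) / c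
  m<m : (∀ i → s ≤ agreeCount xs x0 i) → m < m
  m<m s≤agree = c*d+n*s≤c*n⇒d≤[c∸s]*n/c
    (double-count-≤ x0 xs s≤agree (λ j → d>m x0 (xs j) x0∈C (xs∈C j) (x0≢xs j)))
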